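{- For every $n\ge1$, the rubbling number of the path $P_n$ on $n$ vertices is $\rho(P_n)=2^{n-1}$.
   Context: A pebble distribution on a graph $G$ is a function $p:V(G)\to\mathbb{Z}_{\ge0}$, its size is $\sum_v p(v)$. If $\{v,u\}\in E(G)$, the pebbling move $(v,v\to u)$ removes two pebbles at $v$ and adds one at $u$. If $v\ne w$ and $\{v,u\},\{w,u\}\in E(G)$, the strict rubbling move $(v,w\to u)$ removes one pebble at each of $v$ and $w$ and adds one at $u$. A rubbling move is either of these. A vertex $x$ is reachable from $p$ if there is a sequence of rubbling moves, with pebble counts never becoming negative, after which $x$ has at least one pebble. The rubbling number $\rho(G)$ is the minimum $m$ such that every vertex of $G$ is reachable from every pebble distribution of size $m$. -}

module Defs where

open import Data.Nat using (ℕ; zero; suc; _+_; _∸_; _^_; _≤_)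
open import Data.Fin using (Fin; toℕ; _≟_)
open import Data.List using (map; allFin)
open import Data.Nat.ListAction using (sum)
open import Data.Product using (_×_)
open import Data.Sum using (_⊎_)
open import Relation.Nullary using (¬_; yes; no)
open import Relation.Binary.PropositionalEquality using (_≡_)
open import Relation.Binary.Construct.Closure.ReflexiveTransitive using (Star)

-- A graph on vertex set Fin n, given by its adjacency relation
-- (edges {v,u} are read as Adj v u, Adj is assumed symmetric by the user).
record Graph : Set₁ where
  field
    order : ℕ
    Adj   : Fin order → Fin order → Set

open Graph public

Distribution : Graph → Set
Distribution G = Fin (order G) → ℕ

size : {G : Graph} → Distribution G → ℕ
size {G} p = sum (map p (allFin (order G)))

update : {G : Graph} → Distribution G → Fin (order G) → (ℕ → ℕ) → Distribution G
update p v f x with x ≟ v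
... | yes _ = f (p x)
... | no  _ = p x

data Move (G : Graph) (p : Distribution G) : Distribution G → Set where
  pebbling : (v u : Fin (order G)) → Adj G v u → 2 ≤ p v →
             Move G p (update {G} (update {G} p v (λ k → k ∸ 2)) u suc)
  strict   : (v w u : Fin (order G)) → ¬ v ≡ w → Adj G v u → Adj G w u →
             1 ≤ p v → 1 ≤ p w →
             Move G p (update {G} (update {G} (update {G} p v (λ k → k ∸ 1)) w (λ k → k ∸ 1)) u suc)

-- sequences of rubbling moves (counts never negative, enforced by move preconditions)
Moves : (G : Graph) → Distribution G → Distribution G → Set
Moves G = Star (Move G)

data Reachable (G : Graph) (p : Distribution G) (x : Fin (order G)) : Set where
  reach : (q : Distribution G) → Moves G p q → 1 ≤ q x → Reachable G p x

Solvable : Graph → ℕ → Set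
Solvable G m = (p : Distribution G) → size {G} p ≡ m → (x : Fin (order G)) → Reachable G p x

IsRubblingNumber : Graph → ℕ → Set
IsRubblingNumber G m = Solvable G m × ((k : ℕ) → Solvable G k → m ≤ k)

Path : ℕ → Graph
Path n = record { order = n ; Adj = λ i j → (suc (toℕ i) ≡ toℕ j) ⊎ (suc (toℕ j) ≡ toℕ i) }

-- Upper bound: the path is a simple walk through all its vertices. Split it at the target x into
-- two halves with a and b steps, a + b = n - 1. As 2^a + 2^b ≤ 2^(a+b) + 1, one half carries at
-- least 2^(its number of steps) pebbles, and repeatedly moving half of the pebbles at the far end
-- of that half one step towards x brings a pebble to x; only pebbling moves are needed.
-- Lower bound: as 2^u ≤ 2^v + 2^w for any two neighbours v, w of u, the weight Σᵢ p(i)·2^i never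
-- increases under a rubbling move. Putting all pebbles on vertex 0 gives weight equal to their
-- number, and a pebble on the last vertex needs weight 2^(n-1).
module Submission where

open import Defs
open import Data.Nat using (ℕ; zero; suc; _+_; _*_; _≤_; _^_; _∸_; z≤n; s≤s; _≤?_; ⌊_/2⌋)
open import Data.Nat.Properties hiding (_≟_)
open import Data.Nat.ListAction using (sum)
open import Data.Nat.ListAction.Properties using (sum-++; sum-↭)
open import Data.Fin using (Fin; zero; suc; toℕ; fromℕ; _≟_)
import Data.Fin.Properties as Fin
open import Data.List using (List; []; _∷_; _++_; map; reverse; length; tabulate; allFin)
open import Data.List.Properties
  using (++-identityʳ; ∷ʳ-++; unfold-reverse; reverse-map; map-++; map-tabulate; tabulate-cong;
         length-++; length-reverse; length-tabulate)
open import Data.List.Membership.Propositional using (_∈_; _∉_)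
open import Data.List.Membership.Propositional.Properties using (∈-allFin)
open import Data.List.Relation.Unary.Any using (here; there)
open import Data.List.Relation.Unary.All using (All; []; _∷_)
open import Data.List.Relation.Unary.All.Properties using (¬Any⇒All¬; All¬⇒¬Any; ++⁻ˡ; ++⁻ʳ)
open import Data.List.Relation.Unary.AllPairs using ([]; _∷_)
open import Data.List.Relation.Unary.Unique.Propositional using (Unique)
open import Data.List.Relation.Unary.Unique.Propositional.Properties using (allFin⁺)
open import Data.List.Relation.Binary.Permutation.Propositional using (↭⇒↭ₛ; ↭-sym)
open import Data.List.Relation.Binary.Permutation.Propositional.Properties using (↭-reverse)
import Data.List.Relation.Binary.Permutation.Setoid.Properties as Permutation
open import Data.Product using (_×_; _,_; proj₁; proj₂; ∃; ∃₂)
open import Data.Sum as Sum using (_⊎_; inj₁; inj₂)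
open import Function using (_∘_)
open import Relation.Nullary using (yes; no; contradiction)
open import Relation.Binary using (Rel; Symmetric)
open import Relation.Binary.PropositionalEquality
open import Relation.Binary.Construct.Closure.ReflexiveTransitive
  using (Star; ε; _◅_; _◅◅_; gmap; revApp)
  renaming (reverse to Star-reverse)

2*⌊n/2⌋≤n : ∀ n → 2 * ⌊ n /2⌋ ≤ n
2*⌊n/2⌋≤n zero          = z≤n
2*⌊n/2⌋≤n (suc zero)    = z≤n
2*⌊n/2⌋≤n (suc (suc n)) = subst (_≤ 2 + n) (sym (*-suc 2 ⌊ n /2⌋)) (s≤s (s≤s (2*⌊n/2⌋≤n n)))

2*k≤m+n⇒k≤⌊m/2⌋+n : ∀ k m n → 2 * k ≤ m + n → k ≤ ⌊ m /2⌋ + n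
2*k≤m+n⇒k≤⌊m/2⌋+n zero    m             n _    = z≤n
2*k≤m+n⇒k≤⌊m/2⌋+n (suc k) zero          n 2k≤n = ≤-trans (m≤m+n (suc k) _) 2k≤n
2*k≤m+n⇒k≤⌊m/2⌋+n (suc k) (suc zero)    n 2k≤1+n with subst (_≤ 1 + n) (*-suc 2 k) 2k≤1+n
... | s≤s 1+2k≤n = ≤-trans (s≤s (m≤m+n k _)) 1+2k≤n
2*k≤m+n⇒k≤⌊m/2⌋+n (suc k) (suc (suc m)) n 2k≤2+m+n with subst (_≤ 2 + m + n) (*-suc 2 k) 2k≤2+m+n
... | s≤s (s≤s 2k≤m+n) = s≤s (2*k≤m+n⇒k≤⌊m/2⌋+n k m n 2k≤m+n)

1+m≡n⇒2^m≤2^n : ∀ {m n} → suc m ≡ n → 2 ^ m ≤ 2 ^ n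
1+m≡n⇒2^m≤2^n {m} refl = ^-monoʳ-≤ 2 (n≤1+n m)

2^m+2^n≤2^[m+n]+1 : ∀ m n → 2 ^ m + 2 ^ n ≤ 2 ^ (m + n) + 1
2^m+2^n≤2^[m+n]+1 zero    n = ≤-reflexive (+-comm 1 (2 ^ n))
2^m+2^n≤2^[m+n]+1 (suc m) n = begin
  2 ^ m + (2 ^ m + 0) + 2 ^ n     ≡⟨ cong (λ z → 2 ^ m + z + 2 ^ n) (+-identityʳ (2 ^ m)) ⟩
  2 ^ m + 2 ^ m + 2 ^ n           ≡⟨ +-assoc (2 ^ m) (2 ^ m) (2 ^ n) ⟩
  2 ^ m + (2 ^ m + 2 ^ n)         ≤⟨ +-mono-≤ (^-monoʳ-≤ 2 (m≤m+n m n)) (2^m+2^n≤2^[m+n]+1 m n) ⟩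
  2 ^ (m + n) + (2 ^ (m + n) + 1) ≡⟨ +-assoc (2 ^ (m + n)) _ 1 ⟨
  2 ^ (m + n) + 2 ^ (m + n) + 1   ≡⟨ cong (λ z → 2 ^ (m + n) + z + 1) (+-identityʳ (2 ^ (m + n))) ⟨
  2 ^ suc (m + n) + 1             ∎
  where open ≤-Reasoning

2^[a+b]≤m+n⇒2^a≤m⊎2^b≤n : ∀ a b {m n} → 2 ^ (a + b) ≤ m + n → 2 ^ a ≤ m ⊎ 2 ^ b ≤ n
2^[a+b]≤m+n⇒2^a≤m⊎2^b≤n a b {m} {n} 2^[a+b]≤m+n with 2 ^ a ≤? m | 2 ^ b ≤? n
... | yes 2^a≤m | _         = inj₁ 2^a≤m
... | no  _     | yes 2^b≤n = inj₂ 2^b≤n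
... | no  2^a≰m | no  2^b≰n =
  contradiction (≤-trans 2+m+n≤1+2^[a+b] (s≤s 2^[a+b]≤m+n)) (n≮n (suc (m + n)))
  where
  2+m+n≤1+2^[a+b] : 2 + (m + n) ≤ 1 + 2 ^ (a + b)
  2+m+n≤1+2^[a+b] = begin
    2 + (m + n)     ≡⟨ cong suc (+-suc m n) ⟨
    suc m + suc n   ≤⟨ +-mono-≤ (≰⇒> 2^a≰m) (≰⇒> 2^b≰n) ⟩
    2 ^ a + 2 ^ b   ≤⟨ 2^m+2^n≤2^[m+n]+1 a b ⟩
    2 ^ (a + b) + 1 ≡⟨ +-comm (2 ^ (a + b)) 1 ⟩
    1 + 2 ^ (a + b) ∎
    where open ≤-Reasoning

Unique-++⁻ : ∀ {a} {A : Set a} (xs : List A) {ys} → Unique (xs ++ ys) → Unique xs × Unique ys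
Unique-++⁻ []       uniq        = [] , uniq
Unique-++⁻ (_ ∷ xs) (x∉ ∷ uniq) with Unique-++⁻ xs uniq
... | uniq-xs , uniq-ys = ++⁻ˡ xs x∉ ∷ uniq-xs , uniq-ys

Unique-++⇒∉ : ∀ {a} {A : Set a} (xs : List A) {ys x} → Unique (xs ++ ys) → x ∈ xs → x ∉ ys
Unique-++⇒∉ (x ∷ xs) (x∉ ∷ _)   (here refl) = All¬⇒¬Any (++⁻ʳ xs x∉)
Unique-++⇒∉ (_ ∷ xs) (_ ∷ uniq) (there x∈)  = Unique-++⇒∉ xs uniq x∈

Unique-reverse : ∀ {a} {A : Set a} {xs : List A} → Unique xs → Unique (reverse xs)
Unique-reverse {A = A} {xs} = Permutation.Unique-resp-↭ (setoid A) (↭⇒↭ₛ (↭-sym (↭-reverse xs)))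

sum-map-reverse : ∀ {a} {A : Set a} (f : A → ℕ) xs → sum (map f (reverse xs)) ≡ sum (map f xs)
sum-map-reverse f xs = trans (cong sum (reverse-map f xs)) (sum-↭ (↭-reverse (map f xs)))

sum-tabulate-≥ : ∀ {n} (f : Fin n → ℕ) i → f i ≤ sum (tabulate f)
sum-tabulate-≥ f zero    = m≤m+n (f zero) _
sum-tabulate-≥ f (suc i) = ≤-trans (sum-tabulate-≥ (f ∘ suc) i) (m≤n+m _ (f zero))

sum-tabulate-0 : ∀ n → sum (tabulate {n = n} (λ _ → 0)) ≡ 0
sum-tabulate-0 zero    = refl
sum-tabulate-0 (suc n) = sum-tabulate-0 n

-- Both sides are moved so that no subtraction occurs.
sum-tabulate-update : ∀ {n} (f g : Fin n → ℕ) v → (∀ {i} → i ≢ v → f i ≡ g i) →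
                      sum (tabulate f) + g v ≡ sum (tabulate g) + f v
sum-tabulate-update f g zero f≗g = begin
  f zero + F + g zero   ≡⟨ cong (λ z → f zero + z + g zero) F≡G ⟩
  f zero + G + g zero   ≡⟨ +-assoc (f zero) G (g zero) ⟩
  f zero + (G + g zero) ≡⟨ +-comm (f zero) _ ⟩
  G + g zero + f zero   ≡⟨ cong (_+ f zero) (+-comm G (g zero)) ⟩
  g zero + G + f zero   ∎
  where
  open ≡-Reasoning
  F G : ℕ
  F = sum (tabulate (f ∘ suc))
  G = sum (tabulate (g ∘ suc))
  F≡G : F ≡ G
  F≡G = cong sum (tabulate-cong (λ i → f≗g {suc i} λ ()))
sum-tabulate-update f g (suc v) f≗g = begin
  f zero + F + g (suc v)   ≡⟨ +-assoc (f zero) F _ ⟩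
  f zero + (F + g (suc v)) ≡⟨ cong₂ _+_ (f≗g {zero} λ ()) F+g≡G+f ⟩
  g zero + (G + f (suc v)) ≡⟨ +-assoc (g zero) G _ ⟨
  g zero + G + f (suc v)   ∎
  where
  open ≡-Reasoning
  F G : ℕ
  F = sum (tabulate (f ∘ suc))
  G = sum (tabulate (g ∘ suc))
  F+g≡G+f : F + g (suc v) ≡ G + f (suc v)
  F+g≡G+f = sum-tabulate-update (f ∘ suc) (g ∘ suc) v (λ i≢v → f≗g (i≢v ∘ Fin.suc-injective))

module _ {a r} {A : Set a} {R : Rel A r} where

  arrivals : ∀ {x y} → Star R x y → List A
  arrivals ε                 = []
  arrivals (_◅_ {j = y} _ w) = y ∷ arrivals w

  vertices : ∀ {x y} → Star R x y → List A
  vertices {x} w = x ∷ arrivals w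

  steps : ∀ {x y} → Star R x y → ℕ
  steps w = length (arrivals w)

  total : ∀ {x y} → (A → ℕ) → Star R x y → ℕ
  total f w = sum (map f (vertices w))

  vertices-◅◅ : ∀ {x y z} (w₁ : Star R x y) (w₂ : Star R y z) →
                vertices (w₁ ◅◅ w₂) ≡ vertices w₁ ++ arrivals w₂
  vertices-◅◅     ε        w₂ = refl
  vertices-◅◅ {x} (_ ◅ w₁) w₂ = cong (x ∷_) (vertices-◅◅ w₁ w₂)

  steps-◅◅ : ∀ {x y z} (w₁ : Star R x y) (w₂ : Star R y z) →
             steps (w₁ ◅◅ w₂) ≡ steps w₁ + steps w₂
  steps-◅◅ w₁ w₂ = suc-injective (trans (cong length (vertices-◅◅ w₁ w₂)) (length-++ (vertices w₁)))

  total-◅◅ : ∀ {x y z} f (w₁ : Star R x y) (w₂ : Star R y z) →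
             total f (w₁ ◅◅ w₂) ≤ total f w₁ + total f w₂
  total-◅◅ {y = y} f w₁ w₂ = begin
    sum (map f (vertices (w₁ ◅◅ w₂)))                ≡⟨ cong (sum ∘ map f) (vertices-◅◅ w₁ w₂) ⟩
    sum (map f (vertices w₁ ++ arrivals w₂))         ≡⟨ cong sum (map-++ f (vertices w₁) _) ⟩
    sum (map f (vertices w₁) ++ map f (arrivals w₂)) ≡⟨ sum-++ (map f (vertices w₁)) _ ⟩
    total f w₁ + sum (map f (arrivals w₂))           ≤⟨ +-monoʳ-≤ (total f w₁) (m≤n+m _ (f y)) ⟩
    total f w₁ + total f w₂                          ∎
    where open ≤-Reasoning

  target∈vertices : ∀ {x y} (w : Star R x y) → y ∈ vertices w
  target∈vertices ε       = here refl
  target∈vertices (_ ◅ w) = there (target∈vertices w)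

  split-at-vertex : ∀ {x y z} (w : Star R x y) → z ∈ vertices w →
                    ∃₂ λ (w₁ : Star R x z) (w₂ : Star R z y) → w ≡ w₁ ◅◅ w₂
  split-at-vertex ε       (here refl) = ε , ε , refl
  split-at-vertex (e ◅ w) (here refl) = ε , e ◅ w , refl
  split-at-vertex (e ◅ w) (there z∈w) with split-at-vertex w z∈w
  ... | w₁ , w₂ , w≡w₁◅◅w₂ = e ◅ w₁ , w₂ , cong (e ◅_) w≡w₁◅◅w₂

  Unique-◅◅⁻ : ∀ {x y z} (w₁ : Star R x y) (w₂ : Star R y z) → Unique (vertices (w₁ ◅◅ w₂)) →
               Unique (vertices w₁) × Unique (vertices w₂)
  Unique-◅◅⁻ {y = y} w₁ w₂ uniq = proj₁ halves , ¬Any⇒All¬ (arrivals w₂) y∉w₂ ∷ proj₂ halves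
    where
    uniq′ : Unique (vertices w₁ ++ arrivals w₂)
    uniq′ = subst Unique (vertices-◅◅ w₁ w₂) uniq
    halves : Unique (vertices w₁) × Unique (arrivals w₂)
    halves = Unique-++⁻ (vertices w₁) uniq′
    y∉w₂ : y ∉ arrivals w₂
    y∉w₂ = Unique-++⇒∉ (vertices w₁) uniq′ (target∈vertices w₁)

  module _ (symmetric : Symmetric R) where

    vertices-revApp : ∀ {x y z} (w : Star R y x) (acc : Star R y z) →
                      vertices (revApp symmetric w acc) ≡ reverse (vertices w) ++ arrivals acc
    vertices-revApp         ε       acc = refl
    vertices-revApp {y = y} (e ◅ w) acc = begin
      vertices (revApp symmetric w (symmetric e ◅ acc)) ≡⟨ vertices-revApp w (symmetric e ◅ acc) ⟩
      reverse (vertices w) ++ y ∷ arrivals acc           ≡⟨ ∷ʳ-++ (reverse (vertices w)) y (arrivals acc) ⟨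
      (reverse (vertices w) ++ y ∷ []) ++ arrivals acc   ≡⟨ cong (_++ arrivals acc) (unfold-reverse y (vertices w)) ⟨
      reverse (vertices (e ◅ w)) ++ arrivals acc         ∎
      where open ≡-Reasoning

    vertices-reverse : ∀ {x y} (w : Star R x y) → vertices (Star-reverse symmetric w) ≡ reverse (vertices w)
    vertices-reverse w = trans (vertices-revApp w ε) (++-identityʳ _)

    steps-reverse : ∀ {x y} (w : Star R x y) → steps (Star-reverse symmetric w) ≡ steps w
    steps-reverse w = suc-injective (trans (cong length (vertices-reverse w)) (length-reverse (vertices w)))

    total-reverse : ∀ {x y} f (w : Star R x y) → total f (Star-reverse symmetric w) ≡ total f w
    total-reverse f w = trans (cong (sum ∘ map f) (vertices-reverse w)) (sum-map-reverse f (vertices w))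

vertices-gmap : ∀ {a b r s} {A : Set a} {B : Set b} {R : Rel A r} {S : Rel B s} {x y}
                (f : A → B) (g : ∀ {u v} → R u v → S (f u) (f v)) (w : Star R x y) →
                vertices {R = S} (gmap f g w) ≡ map f (vertices w)
vertices-gmap         f g ε       = refl
vertices-gmap {x = x} f g (_ ◅ w) = cong (f x ∷_) (vertices-gmap f g w)

-- Pebbling along a simple walk

module _ {G : Graph} (p : Distribution G) (v : Fin (order G)) (f : ℕ → ℕ) where

  update-≡ : update {G} p v f v ≡ f (p v)
  update-≡ with v ≟ v
  ... | yes _   = refl
  ... | no  v≢v = contradiction refl v≢v

  update-≢ : ∀ {x} → x ≢ v → update {G} p v f x ≡ p x
  update-≢ {x} x≢v with x ≟ v
  ... | yes x≡v = contradiction x≡v x≢v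
  ... | no  _   = refl

reachable-◅◅ : ∀ {G p q x} → Moves G p q → Reachable G q x → Reachable G p x
reachable-◅◅ ms (reach r ms′ 1≤rx) = reach r (ms ◅◅ ms′) 1≤rx

Transfer : (G : Graph) → Distribution G → (v u : Fin (order G)) → ℕ → Set
Transfer G p v u k = ∃ λ q → Moves G p q × q u ≡ p u + k × (∀ {x} → x ≢ v → x ≢ u → q x ≡ p x)

pebble-repeatedly : ∀ {G} {p : Distribution G} {v u} k → Adj G v u → u ≢ v → 2 * k ≤ p v →
                    Transfer G p v u k
pebble-repeatedly {p = p} {u = u} zero _ _ _ = p , ε , sym (+-identityʳ (p u)) , λ _ _ → refl
pebble-repeatedly {G} {p} {v} {u} (suc k) v~u u≢v 2[1+k]≤pv =
  extend (pebble-repeatedly k v~u u≢v (subst (2 * k ≤_) (sym p₁v≡pv∸2) (∸-monoˡ-≤ 2 2+2k≤pv)))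
  where
  2+2k≤pv : 2 + 2 * k ≤ p v
  2+2k≤pv = subst (_≤ p v) (*-suc 2 k) 2[1+k]≤pv
  p₀ p₁ : Distribution G
  p₀ = update {G} p v (_∸ 2)
  p₁ = update {G} p₀ u suc
  p₁v≡pv∸2 : p₁ v ≡ p v ∸ 2
  p₁v≡pv∸2 = trans (update-≢ p₀ u suc (≢-sym u≢v)) (update-≡ p v (_∸ 2))
  extend : Transfer G p₁ v u k → Transfer G p v u (suc k)
  extend (q , ms , qu≡p₁u+k , q≗p₁) =
    q , pebbling v u v~u (m+n≤o⇒m≤o 2 2+2k≤pv) ◅ ms , qu≡pu+1+k , q≗p
    where
    qu≡pu+1+k : q u ≡ p u + suc k
    qu≡pu+1+k = begin
      q u            ≡⟨ qu≡p₁u+k ⟩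
      p₁ u + k       ≡⟨ cong (_+ k) (update-≡ p₀ u suc) ⟩
      suc (p₀ u) + k ≡⟨ cong (λ z → suc z + k) (update-≢ p v (_∸ 2) u≢v) ⟩
      suc (p u) + k  ≡⟨ +-suc (p u) k ⟨
      p u + suc k    ∎
      where open ≡-Reasoning
    q≗p : ∀ {x} → x ≢ v → x ≢ u → q x ≡ p x
    q≗p x≢v x≢u = trans (q≗p₁ x≢v x≢u) (trans (update-≢ p₀ u suc x≢u) (update-≢ p v (_∸ 2) x≢v))

reachable-along : ∀ {G p v x} (w : Star (Adj G) v x) → Unique (vertices w) →
                  2 ^ steps w ≤ total p w → Reachable G p x
reachable-along {p = p} {x = x} ε _ 1≤px+0 = reach p ε (subst (1 ≤_) (+-identityʳ (p x)) 1≤px+0)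
reachable-along {G} {p} {v} (_◅_ {j = u} v~u w) ((v≢u ∷ v∉w) ∷ uniq@(u∉w ∷ _)) bound
  with pebble-repeatedly ⌊ p v /2⌋ v~u (≢-sym v≢u) (2*⌊n/2⌋≤n (p v))
... | q , ms , qu≡ , q≗p = reachable-◅◅ ms (reachable-along w uniq bound′)
  where
  S : ℕ
  S = sum (map p (arrivals w))
  agree : ∀ {xs} → All (v ≢_) xs → All (u ≢_) xs → map q xs ≡ map p xs
  agree []           []           = refl
  agree (v≢x ∷ v≢xs) (u≢x ∷ u≢xs) = cong₂ _∷_ (q≗p (≢-sym v≢x) (≢-sym u≢x)) (agree v≢xs u≢xs)
  gained : total q w ≡ ⌊ p v /2⌋ + (p u + S)
  gained = begin
    q u + sum (map q (arrivals w)) ≡⟨ cong₂ _+_ qu≡ (cong sum (agree v∉w u∉w)) ⟩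
    p u + ⌊ p v /2⌋ + S           ≡⟨ cong (_+ S) (+-comm (p u) _) ⟩
    ⌊ p v /2⌋ + p u + S           ≡⟨ +-assoc ⌊ p v /2⌋ (p u) S ⟩
    ⌊ p v /2⌋ + (p u + S)         ∎
    where open ≡-Reasoning
  bound′ : 2 ^ steps w ≤ total q w
  bound′ = subst (2 ^ steps w ≤_) (sym gained) (2*k≤m+n⇒k≤⌊m/2⌋+n (2 ^ steps w) (p v) (p u + S) bound)

reachable-along-reverse : ∀ {G p x y} → Symmetric (Adj G) → (w : Star (Adj G) x y) →
                          Unique (vertices w) → 2 ^ steps w ≤ total p w → Reachable G p x
reachable-along-reverse {p = p} symmetric w uniq bound =
  reachable-along (Star-reverse symmetric w)
    (subst Unique (sym (vertices-reverse symmetric w)) (Unique-reverse uniq))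
    (subst₂ (λ l t → 2 ^ l ≤ t) (sym (steps-reverse symmetric w)) (sym (total-reverse symmetric p w)) bound)

-- At least one of the two halves of the walk, split at x, carries enough pebbles.
reachable-on-simple-walk : ∀ {G p v y x} → Symmetric (Adj G) → (w : Star (Adj G) v y) →
                           Unique (vertices w) → x ∈ vertices w →
                           2 ^ steps w ≤ total p w → Reachable G p x
reachable-on-simple-walk {p = p} symmetric w uniq x∈w bound with split-at-vertex w x∈w
... | w₁ , w₂ , refl
  with Unique-◅◅⁻ w₁ w₂ uniq
     | 2^[a+b]≤m+n⇒2^a≤m⊎2^b≤n (steps w₁) (steps w₂) (begin
         2 ^ (steps w₁ + steps w₂) ≡⟨ cong (2 ^_) (steps-◅◅ w₁ w₂) ⟨
         2 ^ steps (w₁ ◅◅ w₂)      ≤⟨ bound ⟩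
         total p (w₁ ◅◅ w₂)        ≤⟨ total-◅◅ p w₁ w₂ ⟩
         total p w₁ + total p w₂   ∎)
  where open ≤-Reasoning
... | uniq₁ , _     | inj₁ rich₁ = reachable-along w₁ uniq₁ rich₁
... | _     , uniq₂ | inj₂ rich₂ = reachable-along-reverse symmetric w₂ uniq₂ rich₂

-- Weight

module _ {G : Graph} (φ : Fin (order G) → ℕ) where

  weight : Distribution G → ℕ
  weight p = sum (tabulate (λ i → p i * φ i))

  weight-update : ∀ p v f → weight (update {G} p v f) + p v * φ v ≡ weight p + f (p v) * φ v
  weight-update p v f = trans
    (sum-tabulate-update (λ i → update {G} p v f i * φ i) (λ i → p i * φ i) v
       (λ i≢v → cong (_* φ _) (update-≢ p v f i≢v)))
    (cong (λ k → weight p + k * φ v) (update-≡ p v f))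

  weight-gain : ∀ p u → weight (update {G} p u suc) ≡ weight p + φ u
  weight-gain p u = +-cancelʳ-≡ (p u * φ u) _ _
    (trans (weight-update p u suc) (sym (+-assoc (weight p) (φ u) (p u * φ u))))

  weight-loss : ∀ p v k → k ≤ p v → weight (update {G} p v (_∸ k)) + k * φ v ≡ weight p
  weight-loss p v k k≤pv = +-cancelʳ-≡ ((p v ∸ k) * φ v) _ _ (begin
    weight p′ + k * φ v + (p v ∸ k) * φ v   ≡⟨ +-assoc (weight p′) _ _ ⟩
    weight p′ + (k * φ v + (p v ∸ k) * φ v) ≡⟨ cong (weight p′ +_) (*-distribʳ-+ (φ v) k (p v ∸ k)) ⟨
    weight p′ + (k + (p v ∸ k)) * φ v       ≡⟨ cong (λ m → weight p′ + m * φ v) (m+[n∸m]≡n k≤pv) ⟩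
    weight p′ + p v * φ v                   ≡⟨ weight-update p v (_∸ k) ⟩
    weight p + (p v ∸ k) * φ v              ∎)
    where
    open ≡-Reasoning
    p′ : Distribution G
    p′ = update {G} p v (_∸ k)

  -- With v = w the condition also covers pebbling moves.
  module _ (φ-subadditive : ∀ {v w u} → Adj G v u → Adj G w u → φ u ≤ φ v + φ w) where

    weight-move : ∀ {p q} → Move G p q → weight q ≤ weight p
    weight-move {p} (pebbling v u v~u 2≤pv) = begin
      weight (update {G} p₁ u suc) ≡⟨ weight-gain p₁ u ⟩
      weight p₁ + φ u              ≤⟨ +-monoʳ-≤ (weight p₁) (φ-subadditive v~u v~u) ⟩
      weight p₁ + (φ v + φ v)      ≡⟨ cong (λ m → weight p₁ + (φ v + m)) (+-identityʳ (φ v)) ⟨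
      weight p₁ + 2 * φ v          ≡⟨ weight-loss p v 2 2≤pv ⟩
      weight p                     ∎
      where
      open ≤-Reasoning
      p₁ : Distribution G
      p₁ = update {G} p v (_∸ 2)
    weight-move {p} (strict v w u v≢w v~u w~u 1≤pv 1≤pw) = begin
      weight (update {G} p₂ u suc) ≡⟨ weight-gain p₂ u ⟩
      weight p₂ + φ u              ≤⟨ +-monoʳ-≤ (weight p₂) (φ-subadditive w~u v~u) ⟩
      weight p₂ + (φ w + φ v)      ≡⟨ +-assoc (weight p₂) (φ w) (φ v) ⟨
      weight p₂ + φ w + φ v        ≡⟨ cong (λ m → weight p₂ + m + φ v) (*-identityˡ (φ w)) ⟨
      weight p₂ + 1 * φ w + φ v    ≡⟨ cong (_+ φ v) (weight-loss p₁ w 1 1≤p₁w) ⟩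
      weight p₁ + φ v              ≡⟨ cong (weight p₁ +_) (*-identityˡ (φ v)) ⟨
      weight p₁ + 1 * φ v          ≡⟨ weight-loss p v 1 1≤pv ⟩
      weight p                     ∎
      where
      open ≤-Reasoning
      p₁ p₂ : Distribution G
      p₁ = update {G} p v (_∸ 1)
      p₂ = update {G} p₁ w (_∸ 1)
      1≤p₁w : 1 ≤ p₁ w
      1≤p₁w = subst (1 ≤_) (sym (update-≢ p v (_∸ 1) (≢-sym v≢w))) 1≤pw

    weight-moves : ∀ {p q} → Moves G p q → weight q ≤ weight p
    weight-moves ε        = ≤-refl
    weight-moves (m ◅ ms) = ≤-trans (weight-moves ms) (weight-move m)

    reachable⇒φ≤weight : ∀ {p x} → Reachable G p x → φ x ≤ weight p
    reachable⇒φ≤weight {p} {x} (reach q ms 1≤qx) = begin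
      φ x       ≡⟨ *-identityˡ (φ x) ⟨
      1 * φ x   ≤⟨ *-monoˡ-≤ (φ x) 1≤qx ⟩
      q x * φ x ≤⟨ sum-tabulate-≥ (λ i → q i * φ i) x ⟩
      weight q  ≤⟨ weight-moves ms ⟩
      weight p  ∎
      where open ≤-Reasoning

Path-symmetric : ∀ n → Symmetric (Adj (Path n))
Path-symmetric n = Sum.swap

Path-adj-suc : ∀ {n} {i j : Fin n} → Adj (Path n) i j → Adj (Path (suc n)) (suc i) (suc j)
Path-adj-suc = Sum.map (cong suc) (cong suc)

spine : ∀ n → Star (Adj (Path (suc n))) zero (fromℕ n)
spine zero    = ε
spine (suc n) = inj₁ refl ◅ gmap suc Path-adj-suc (spine n)

vertices-spine : ∀ n → vertices (spine n) ≡ allFin (suc n)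
vertices-spine zero    = refl
vertices-spine (suc n) = cong (zero ∷_) (begin
  vertices (gmap suc Path-adj-suc (spine n)) ≡⟨ vertices-gmap suc Path-adj-suc (spine n) ⟩
  map suc (vertices (spine n))               ≡⟨ cong (map suc) (vertices-spine n) ⟩
  map suc (allFin (suc n))                   ≡⟨ map-tabulate (λ i → i) suc ⟩
  tabulate suc                               ∎)
  where open ≡-Reasoning

steps-spine : ∀ n → steps (spine n) ≡ n
steps-spine n = suc-injective (trans (cong length (vertices-spine n)) (length-tabulate (λ i → i)))

path-solvable : ∀ n → Solvable (Path (suc n)) (2 ^ n)
path-solvable n p size≡2^n x =
  reachable-on-simple-walk (Path-symmetric (suc n)) (spine n)
    (subst Unique (sym (vertices-spine n)) (allFin⁺ (suc n)))
    (subst (x ∈_) (sym (vertices-spine n)) (∈-allFin x))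
    (≤-reflexive (begin
      2 ^ steps (spine n)   ≡⟨ cong (2 ^_) (steps-spine n) ⟩
      2 ^ n                 ≡⟨ size≡2^n ⟨
      size {Path (suc n)} p ≡⟨ cong (sum ∘ map p) (vertices-spine n) ⟨
      total p (spine n)     ∎))
  where open ≡-Reasoning

2^toℕ : ∀ {n} → Fin n → ℕ
2^toℕ i = 2 ^ toℕ i

2^toℕ-subadditive : ∀ {n} {v w u : Fin n} → Adj (Path n) v u → Adj (Path n) w u →
                    2^toℕ u ≤ 2^toℕ v + 2^toℕ w
2^toℕ-subadditive {w = w} (inj₂ 1+u≡v) _ =
  ≤-trans (1+m≡n⇒2^m≤2^n 1+u≡v) (m≤m+n _ (2^toℕ w))
2^toℕ-subadditive {v = v} (inj₁ _) (inj₂ 1+u≡w) =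
  ≤-trans (1+m≡n⇒2^m≤2^n 1+u≡w) (m≤n+m _ (2^toℕ v))
2^toℕ-subadditive {v = v} {w} {u} (inj₁ 1+v≡u) (inj₁ 1+w≡u) = ≤-reflexive (begin
  2 ^ toℕ u                   ≡⟨ cong (2 ^_) 1+v≡u ⟨
  2 ^ toℕ v + (2 ^ toℕ v + 0) ≡⟨ cong (2 ^ toℕ v +_) (+-identityʳ _) ⟩
  2 ^ toℕ v + 2 ^ toℕ v       ≡⟨ cong (λ i → 2 ^ toℕ v + 2 ^ i) (suc-injective (trans 1+v≡u (sym 1+w≡u))) ⟩
  2 ^ toℕ v + 2 ^ toℕ w       ∎)
  where open ≡-Reasoning

pile : ∀ {n} → ℕ → Fin (suc n) → ℕ
pile k zero    = k
pile k (suc _) = 0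

size-pile : ∀ n k → size {Path (suc n)} (pile {n} k) ≡ k
size-pile n k = begin
  k + sum (map (pile {n} k) (tabulate suc)) ≡⟨ cong (λ xs → k + sum xs) (map-tabulate suc (pile {n} k)) ⟩
  k + sum (tabulate {n = n} (λ _ → 0))      ≡⟨ cong (k +_) (sum-tabulate-0 n) ⟩
  k + 0                                     ≡⟨ +-identityʳ k ⟩
  k                                         ∎
  where open ≡-Reasoning

weight-pile : ∀ n k → weight {Path (suc n)} 2^toℕ (pile {n} k) ≡ k
weight-pile n k = begin
  k * 1 + sum (tabulate {n = n} (λ _ → 0)) ≡⟨ cong₂ _+_ (*-identityʳ k) (sum-tabulate-0 n) ⟩
  k + 0                                    ≡⟨ +-identityʳ k ⟩
  k                                        ∎
  where open ≡-Reasoning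

path-solvable⇒2^n≤ : ∀ n {k} → Solvable (Path (suc n)) k → 2 ^ n ≤ k
path-solvable⇒2^n≤ n {k} solvable = begin
  2 ^ n                                  ≡⟨ cong (2 ^_) (Fin.toℕ-fromℕ n) ⟨
  2^toℕ (fromℕ n)                        ≤⟨ reachable⇒φ≤weight 2^toℕ 2^toℕ-subadditive
                                              (solvable (pile {n} k) (size-pile n k) (fromℕ n)) ⟩
  weight {Path (suc n)} 2^toℕ (pile {n} k) ≡⟨ weight-pile n k ⟩
  k                                      ∎
  where open ≤-Reasoning

mainTheorem6 : (n : ℕ) → 1 ≤ n → IsRubblingNumber (Path n) (2 ^ (n ∸ 1))
mainTheorem6 (suc n) _ = path-solvable n , λ _ → path-solvable⇒2^n≤ n
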